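{- For a prime $p>3$ and a primitive $p$-th root of unity $\zeta_p$, let $$g(z)=\begin{pmatrix}0&1\\-z&z^2+z+1\end{pmatrix},\qquad \gamma_p=g\bigl(\zeta_p^{4^{(p-1)/2-1}}\bigr)g\bigl(\zeta_p^{4^{(p-1)/2-2}}\bigr)\cdots g(\zeta_p^4)\,g(\zeta_p)$$ (a product of $(p-1)/2$ matrices; $\gamma_p\in\mathrm{SL}_2(\mathbb{C})$). Then there are infinitely many primes $p>3$ for which the eigenvalues $\mu,\mu^{ -1}$ of $\gamma_p$ are not $p$-th roots of unity. -}

module Defs where

open import Data.Nat as ℕ using (ℕ; zero; suc; _^_; _∸_)
open import Data.Nat.DivMod using (_mod_; _/_)
open import Data.Fin as Fin using (Fin; toℕ)
open import Data.Integer as ℤ using (ℤ; 0ℤ; 1ℤ)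
open import Relation.Binary.PropositionalEquality using (_≡_)
open import Relation.Nullary using (¬_; yes; no)

-- The cyclotomic ring ℤ[ζ_p], p = suc n, modelled as the group ring
-- ℤ[C_p] = ℤ[x]/(x^p - 1) (elements: coefficient functions Fin p → ℤ,
-- a ↦ Σ_i a(i) ζ^i), modulo the ideal generated by 1 + x + ... + x^(p-1).
-- That ideal consists exactly of the constant coefficient vectors, so
-- two elements are equal in ℤ[ζ_p] iff their difference is constant.
Cyc : ℕ → Set
Cyc n = Fin (suc n) → ℤ

Σ : ∀ m → (Fin m → ℤ) → ℤ
Σ zero    f = 0ℤ
Σ (suc m) f = f Fin.zero ℤ.+ Σ m (λ i → f (Fin.suc i))

module _ {n : ℕ} where
  p : ℕ
  p = suc n

  _≈_ : Cyc n → Cyc n → Set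
  a ≈ b = ∀ i → a i ℤ.- b i ≡ a Fin.zero ℤ.- b Fin.zero

  0c : Cyc n
  0c _ = 0ℤ

  ζ^ : ℕ → Cyc n
  ζ^ k i with toℕ i ℕ.≟ toℕ (k mod p)
  ... | yes _ = 1ℤ
  ... | no  _ = 0ℤ

  1c : Cyc n
  1c = ζ^ 0

  _+c_ : Cyc n → Cyc n → Cyc n
  (a +c b) i = a i ℤ.+ b i

  -c_ : Cyc n → Cyc n
  (-c a) i = ℤ.- a i

  _-c_ : Cyc n → Cyc n → Cyc n
  a -c b = a +c (-c b)

  -- multiplication: cyclic convolution, (a*b)_k = Σ_{i+j ≡ k mod p} a_i b_j
  _*c_ : Cyc n → Cyc n → Cyc n
  (a *c b) k = Σ p (λ i → a i ℤ.* b (((toℕ k ℕ.+ p) ∸ toℕ i) mod p))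

  record M2 : Set where
    constructor mat
    field a b c d : Cyc n
  open M2 public

  _*M_ : M2 → M2 → M2
  mat a₁ b₁ c₁ d₁ *M mat a₂ b₂ c₂ d₂ =
    mat ((a₁ *c a₂) +c (b₁ *c c₂)) ((a₁ *c b₂) +c (b₁ *c d₂))
        ((c₁ *c a₂) +c (d₁ *c c₂)) ((c₁ *c b₂) +c (d₁ *c d₂))

  IdM : M2
  IdM = mat 1c 0c 0c 1c

  det : M2 → Cyc n
  det (mat a b c d) = (a *c d) -c (b *c c)

  g : Cyc n → M2
  g z = mat 0c 1c (-c z) (((z *c z) +c z) +c 1c)

  γ-prod : ℕ → M2
  γ-prod zero    = IdM
  γ-prod (suc m) = g (ζ^ (4 ^ m)) *M γ-prod m

  γ : M2
  γ = γ-prod ((p ∸ 1) / 2)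

  IsEigenvalue : M2 → Cyc n → Set
  IsEigenvalue (mat a b c d) μ = det (mat (a -c μ) b c (d -c μ)) ≈ 0c

  -- no eigenvalue of γ_p is a p-th root of unity (the p-th roots of unity
  -- are exactly ζ_p^k, k = 0, …, p-1)
  NoRootOfUnityEigenvalue : Set
  NoRootOfUnityEigenvalue = ∀ (k : Fin p) → ¬ IsEigenvalue γ (ζ^ (toℕ k))

module Submission where

-- If an eigenvalue of γ_p were a power of ζ_p, then reducing ℤ[ζ_p] modulo the prime above p
-- (the augmentation ζ ↦ 1 followed by reduction mod p) would make 1 an eigenvalue of g(1)^h,
-- h = (p-1)/2. The matrix g(1) = [[0, 1], [-1, 3]] is the image of 1 + φ = φ² under an embedding of the golden
-- ring ℤ[φ] into M₂(ℤ), so this says p ∣ N(φ^(2h) - 1), N the norm. Take p ≡ 3 (mod 4), p > 5,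
-- with p ∣ y² + 5: then -5 is a square and -1 is not, so 5^h ≡ -1 (mod p). The Frobenius
-- computation (2φ)^p = (√5 + 1)^p ≡ √5 · 5^h + 1 = 2 - 2φ gives φ^p ≡ 1 - φ, hence
-- φ^(2h) ≡ φ - 2 and N(φ^(2h) - 1) ≡ N(φ - 3) = 5, contradicting p > 5. Such primes are
-- unbounded: with Q = 3·5···(2K+1), every prime factor ≡ 3 (mod 4) of ((Q²)² + 5)/2 is coprime
-- to Q, hence larger than 2K + 1.

open import Algebra.Bundles using (CommutativeSemiring)
import Algebra.Properties.Semiring.Exp as SemiringExp
import Algebra.Properties.Semiring.Mult as SemiringMult
open import Data.Empty using (⊥-elim)
open import Data.Fin as Fin using (Fin; toℕ)
open import Data.Fin.Permutation using (Permutation; permutation)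
import Data.Fin.Properties as Fin
open import Data.Integer as ℤ using (ℤ; +_; 0ℤ; 1ℤ)
open import Data.Integer.Divisibility.Signed
  using (_∣_; divides; ∣ᵤ⇒∣; ∣⇒∣ᵤ; ∣m∣n⇒∣m+n; ∣m∣n⇒∣m-n; ∣m⇒∣-m; ∣n⇒∣m*n; ∣m⇒∣m*n)
import Data.Integer.Properties as ℤ
import Data.Integer.Tactic.RingSolver as ℤ-Solver
open import Data.List using (_∷_; [])
open import Data.List.Relation.Unary.All as All using (All)
open import Data.Nat as ℕ using (ℕ; zero; suc; _<_; s≤s; z≤n)
open import Data.Nat.Combinatorics using (_C_; nCn≡1; nC1≡n; nCk+nC[k+1]≡[n+1]C[k+1])
import Data.Nat.Divisibility as ℕ
import Data.Nat.DivMod as ℕ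
open import Data.Nat.ListAction using (product)
open import Data.Nat.Primality using (Prime; euclidsLemma; prime?; prime⇒irreducible)
open import Data.Nat.Primality.Factorisation using (factorise; PrimeFactorisation)
import Data.Nat.Properties as ℕ
import Data.Nat.Tactic.RingSolver as ℕ-Solver
open import Data.Product using (∃-syntax; _,_)
open import Data.Sum using (_⊎_; inj₁; inj₂)
open import Data.Vec.Functional using (Vector; init; tail; last; removeAt)
open import Level using (0ℓ)
open import Relation.Binary.Bundles using (Setoid)
open import Relation.Binary.PropositionalEquality as ≡
  using (_≡_; _≢_; refl; cong; cong₂; subst; subst₂; module ≡-Reasoning)
open import Relation.Nullary using (¬_; yes; no)
open import Relation.Nullary.Decidable using (from-yes)

infixr 9 1+2*_

1+2*_ : ℕ → ℕ
1+2* h = suc (h ℕ.+ h)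

-- Binomial coefficients and the freshman's dream

[k+1]*[n+1]C[k+1]≡[n+1]*nCk : ∀ n k → suc k ℕ.* (suc n C suc k) ≡ suc n ℕ.* (n C k)
[k+1]*[n+1]C[k+1]≡[n+1]*nCk zero    zero    = refl
[k+1]*[n+1]C[k+1]≡[n+1]*nCk zero    (suc k) = ℕ.*-zeroʳ (2 ℕ.+ k)
[k+1]*[n+1]C[k+1]≡[n+1]*nCk (suc n) zero    =
  ≡.trans (ℕ.*-identityˡ _) (≡.trans (nC1≡n (2 ℕ.+ n)) (≡.sym (ℕ.*-identityʳ _)))
[k+1]*[n+1]C[k+1]≡[n+1]*nCk (suc n) (suc k) = begin
  (2 ℕ.+ k) ℕ.* (suc (suc n) C suc (suc k))
    ≡⟨ cong ((2 ℕ.+ k) ℕ.*_) (nCk+nC[k+1]≡[n+1]C[k+1] (suc n) (suc k)) ⟨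
  (2 ℕ.+ k) ℕ.* (A ℕ.+ B)
    ≡⟨ regroup k A B ⟩
  (suc k ℕ.* A ℕ.+ A) ℕ.+ (2 ℕ.+ k) ℕ.* B
    ≡⟨ cong₂ (λ u v → (u ℕ.+ A) ℕ.+ v) ([k+1]*[n+1]C[k+1]≡[n+1]*nCk n k)
                                       ([k+1]*[n+1]C[k+1]≡[n+1]*nCk n (suc k)) ⟩
  (suc n ℕ.* (n C k) ℕ.+ A) ℕ.+ suc n ℕ.* (n C suc k)
    ≡⟨ regroup′ (suc n) (n C k) A (n C suc k) ⟩
  suc n ℕ.* ((n C k) ℕ.+ (n C suc k)) ℕ.+ A
    ≡⟨ cong (λ u → suc n ℕ.* u ℕ.+ A) (nCk+nC[k+1]≡[n+1]C[k+1] n k) ⟩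
  suc n ℕ.* A ℕ.+ A
    ≡⟨ ℕ.+-comm (suc n ℕ.* A) A ⟩
  (2 ℕ.+ n) ℕ.* A
    ∎
  where
  open ≡-Reasoning
  A = suc n C suc k
  B = suc n C suc (suc k)
  regroup : ∀ k A B → (2 ℕ.+ k) ℕ.* (A ℕ.+ B) ≡ (suc k ℕ.* A ℕ.+ A) ℕ.+ (2 ℕ.+ k) ℕ.* B
  regroup = ℕ-Solver.solve-∀
  regroup′ : ∀ m x a y → (m ℕ.* x ℕ.+ a) ℕ.+ m ℕ.* y ≡ m ℕ.* (x ℕ.+ y) ℕ.+ a
  regroup′ = ℕ-Solver.solve-∀

prime∣pCk : ∀ {p k} → Prime p → 0 < k → k < p → p ℕ.∣ p C k
prime∣pCk {suc n} {suc k} pr _ k<p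
  with euclidsLemma (suc k) (suc n C suc k) pr
         (subst (suc n ℕ.∣_) (≡.sym ([k+1]*[n+1]C[k+1]≡[n+1]*nCk n k)) (ℕ.m∣m*n (n C k)))
... | inj₁ p∣k+1 = ⊥-elim (ℕ.<⇒≱ k<p (ℕ.∣⇒≤ p∣k+1))
... | inj₂ p∣pCk = p∣pCk

module _ {a ℓ} (S : CommutativeSemiring a ℓ) where

  open CommutativeSemiring S
  open import Algebra.Properties.CommutativeMonoid.Mult +-commutativeMonoid
    using (_×_; ×-congˡ; ×-assocˡ; ×-distrib-+)
  open import Algebra.Properties.CommutativeSemigroup +-commutativeSemigroup using (x∙yz≈zx∙y)
  open import Algebra.Properties.CommutativeSemiring.Binomial S using (theorem; binomialTerm)
  open import Algebra.Properties.Monoid.Sum +-monoid using (sum; sum-init-last; sum-replicate; sum-replicate-zero)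
  open import Algebra.Properties.Semiring.Exp semiring using (_^_)
  open import Relation.Binary.Reasoning.Setoid setoid

  ×-multiple : ∀ {k c} x → k ℕ.∣ c → ∃[ v ] c × x ≈ k × v
  ×-multiple {k} x (ℕ.divides q refl) = q × x , trans (×-congˡ (ℕ.*-comm q k)) (sym (×-assocˡ x k q))

  sum-multiple : ∀ k {n} (f : Vector Carrier n) → (∀ i → ∃[ v ] f i ≈ k × v) → ∃[ v ] sum f ≈ k × v
  sum-multiple k {zero}  f _        = 0# , trans (sym (sum-replicate-zero k)) (sum-replicate k)
  sum-multiple k {suc n} f multiple with multiple Fin.zero | sum-multiple k (tail f) (λ i → multiple (Fin.suc i))
  ... | u , f₀≈ku | v , rest≈kv = u + v , trans (+-cong f₀≈ku rest≈kv) (sym (×-distrib-+ u v k))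

  freshmans-dream : ∀ {p} → Prime p → ∀ x y → ∃[ v ] (x + y) ^ p ≈ (x ^ p + y ^ p) + p × v
  freshmans-dream {p@(suc (suc m))} pr x y = let v , middle≈pv = middle-multiple in v , (begin
    (x + y) ^ p                                         ≈⟨ theorem p x y ⟩
    t Fin.zero + sum (tail t)                           ≈⟨ +-congˡ (sum-init-last (tail t)) ⟩
    t Fin.zero + (sum (init (tail t)) + last (tail t))  ≈⟨ +-cong first-term (+-cong middle≈pv last-term) ⟩
    y ^ p + (p × v + x ^ p)                             ≈⟨ x∙yz≈zx∙y (y ^ p) (p × v) (x ^ p) ⟩
    (x ^ p + y ^ p) + p × v                             ∎)
    where
    t = binomialTerm x y p
    first-term : t Fin.zero ≈ y ^ p
    first-term = trans (+-identityʳ _) (*-identityˡ _)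
    top-term : ∀ k → k ≡ p → (p C k) × (x ^ k * y ^ (p ℕ.∸ k)) ≈ x ^ p
    top-term _ refl rewrite nCn≡1 p | ℕ.n∸n≡0 p = trans (+-identityʳ _) (*-identityʳ _)
    last-term : last (tail t) ≈ x ^ p
    last-term = top-term _ (Fin.toℕ-fromℕ p)
    middle-multiple : ∃[ v ] sum (init (tail t)) ≈ p × v
    middle-multiple = sum-multiple p (init (tail t)) λ j →
      ×-multiple _ (prime∣pCk pr (s≤s z≤n) (s≤s (subst (_< suc m) (≡.sym (Fin.toℕ-inject₁ j)) (Fin.toℕ<n j))))

-- Opened only from here on: the semiring module above uses the generic _+_, _*_, _≈_, _×_ and sum.
open import Algebra.Properties.CommutativeMonoid.Sum ℤ.+-0-commutativeMonoid
  using (sum; sum-cong-≗; sum-remove; sum-replicate; sum-replicate-zero; sum-permute; ∑-distrib-+; ∑-comm)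
open import Algebra.Properties.CommutativeSemigroup ℤ.*-commutativeSemigroup using (interchange)
open import Algebra.Properties.Semiring.Sum ℤ.+-*-semiring using (*-distribˡ-sum; *-distribʳ-sum)
open import Data.Integer using (_+_; _*_; _-_; -_; _^_)
open import Data.Product using (_×_)
open import Defs
  using ( Σ; Cyc; _≈_; 0c; 1c; ζ^; _+c_; -c_; _-c_; _*c_; M2; mat; _*M_; g; γ-prod
        ; IsEigenvalue; NoRootOfUnityEigenvalue)
open ℤ-Solver using (solve-∀; solve)

-- Congruences of integers and Fermat's little theorem

infix 4 _≡_mod_

record _≡_mod_ (x y : ℤ) (m : ℕ) : Set where
  constructor ≡-mod
  field divides-difference : + m ∣ x - y

module _ {m : ℕ} where

  ≡-mod-refl : ∀ x → x ≡ x mod m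
  ≡-mod-refl x = ≡-mod (subst (+ m ∣_) (≡.sym (ℤ.+-inverseʳ x)) (divides 0ℤ refl))

  ≡⇒≡-mod : ∀ {x y} → x ≡ y → x ≡ y mod m
  ≡⇒≡-mod {x} refl = ≡-mod-refl x

  ≡-mod-sym : ∀ {x y} → x ≡ y mod m → y ≡ x mod m
  ≡-mod-sym {x} {y} (≡-mod d) = ≡-mod (subst (+ m ∣_) (identity x y) (∣m⇒∣-m d))
    where
    identity : ∀ x y → - (x - y) ≡ y - x
    identity = solve-∀

  ≡-mod-trans : ∀ {x y z} → x ≡ y mod m → y ≡ z mod m → x ≡ z mod m
  ≡-mod-trans {x} {y} {z} (≡-mod d) (≡-mod e) =
    ≡-mod (subst (+ m ∣_) (identity x y z) (∣m∣n⇒∣m+n d e))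
    where
    identity : ∀ x y z → (x - y) + (y - z) ≡ x - z
    identity = solve-∀

  ≡-mod-setoid : Setoid _ _
  ≡-mod-setoid = record
    { Carrier       = ℤ
    ; _≈_           = λ x y → x ≡ y mod m
    ; isEquivalence = record { refl = ≡-mod-refl _ ; sym = ≡-mod-sym ; trans = ≡-mod-trans }
    }

  +-cong-mod : ∀ {x y u v} → x ≡ y mod m → u ≡ v mod m → x + u ≡ y + v mod m
  +-cong-mod {x} {y} {u} {v} (≡-mod d) (≡-mod e) =
    ≡-mod (subst (+ m ∣_) (identity x y u v) (∣m∣n⇒∣m+n d e))
    where
    identity : ∀ x y u v → (x - y) + (u - v) ≡ (x + u) - (y + v)
    identity = solve-∀

  *-cong-mod : ∀ {x y u v} → x ≡ y mod m → u ≡ v mod m → x * u ≡ y * v mod m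
  *-cong-mod {x} {y} {u} {v} (≡-mod d) (≡-mod e) =
    ≡-mod (subst (+ m ∣_) (identity x y u v) (∣m∣n⇒∣m+n (∣m⇒∣m*n u d) (∣n⇒∣m*n y e)))
    where
    identity : ∀ x y u v → (x - y) * u + y * (u - v) ≡ x * u - y * v
    identity = solve-∀

  neg-cong-mod : ∀ {x y} → x ≡ y mod m → - x ≡ - y mod m
  neg-cong-mod {x} {y} (≡-mod d) = ≡-mod (subst (+ m ∣_) (identity x y) (∣m⇒∣-m d))
    where
    identity : ∀ x y → - (x - y) ≡ - x - - y
    identity = solve-∀

  ^-cong-mod : ∀ {x y} k → x ≡ y mod m → x ^ k ≡ y ^ k mod m
  ^-cong-mod zero    _ = ≡⇒≡-mod refl
  ^-cong-mod (suc k) e = *-cong-mod e (^-cong-mod k e)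

  ≡-mod-∣ : ∀ {x y} → x ≡ y mod m → + m ∣ x → + m ∣ y
  ≡-mod-∣ {x} {y} (≡-mod d) m∣x = subst (+ m ∣_) (identity x y) (∣m∣n⇒∣m-n m∣x d)
    where
    identity : ∀ x y → x - (x - y) ≡ y
    identity = solve-∀

  multiple≡0-mod : ∀ x → + m * x ≡ 0ℤ mod m
  multiple≡0-mod x = ≡-mod (divides x (≡.trans (ℤ.+-identityʳ (+ m * x)) (ℤ.*-comm (+ m) x)))

euclidsLemma-ℤ : ∀ {p} → Prime p → ∀ x y → + p ∣ x * y → + p ∣ x ⊎ + p ∣ y
euclidsLemma-ℤ {p} pr x y p∣xy =
  Data.Sum.map ∣ᵤ⇒∣ ∣ᵤ⇒∣
    (euclidsLemma ℤ.∣ x ∣ ℤ.∣ y ∣ pr (subst (p ℕ.∣_) (ℤ.abs-* x y) (∣⇒∣ᵤ p∣xy)))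

*-cancelˡ-mod : ∀ {p} → Prime p → ∀ {c} → ¬ (+ p ∣ c) →
                ∀ {x y} → c * x ≡ c * y mod p → x ≡ y mod p
*-cancelˡ-mod pr {c} p∤c {x} {y} (≡-mod d)
  with euclidsLemma-ℤ pr c (x - y) (subst (_ ∣_) (identity c x y) d)
  where
  identity : ∀ c x y → c * x - c * y ≡ c * (x - y)
  identity = solve-∀
... | inj₁ p∣c   = ⊥-elim (p∤c p∣c)
... | inj₂ p∣x-y = ≡-mod p∣x-y

^-distribʳ-* : ∀ x y k → (x * y) ^ k ≡ x ^ k * y ^ k
^-distribʳ-* x y zero    = refl
^-distribʳ-* x y (suc k) = ≡.trans (cong (_*_ (x * y)) (^-distribʳ-* x y k)) (interchange x y (x ^ k) (y ^ k))

^-double : ∀ x k → x ^ (k ℕ.+ k) ≡ (x * x) ^ k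
^-double x k = ≡.trans (ℤ.^-distribˡ-+-* x k k) (≡.sym (^-distribʳ-* x x k))

-‿^-odd : ∀ x r → (- x) ^ 1+2* r ≡ - (x ^ 1+2* r)
-‿^-odd x r = begin
  - x * (- x) ^ (r ℕ.+ r)  ≡⟨ cong (_*_ (- x)) (^-double (- x) r) ⟩
  - x * (- x * - x) ^ r    ≡⟨ cong (λ t → - x * t ^ r) (solve (x ∷ [])) ⟩
  - x * (x * x) ^ r        ≡⟨ ℤ.neg-distribˡ-* x ((x * x) ^ r) ⟨
  - (x * (x * x) ^ r)      ≡⟨ cong (λ t → - (x * t)) (^-double x r) ⟨
  - (x * x ^ (r ℕ.+ r))    ∎
  where open ≡-Reasoning

module ℤ-Exp = SemiringExp ℤ.+-*-semiring
module ℤ-Mult = SemiringMult ℤ.+-*-semiring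

semiring-^≡^ : ∀ x k → x ℤ-Exp.^ k ≡ x ^ k
semiring-^≡^ x zero    = refl
semiring-^≡^ x (suc k) = cong (x *_) (semiring-^≡^ x k)

semiring-×≡* : ∀ k x → k ℤ-Mult.× x ≡ + k * x
semiring-×≡* zero    x = ≡.sym (ℤ.*-zeroˡ x)
semiring-×≡* (suc k) x = ≡.trans (cong (_+_ x) (semiring-×≡* k x)) (≡.sym (ℤ.suc-* (+ k) x))

freshmans-dream-ℤ : ∀ {p} → Prime p → ∀ x y → (x + y) ^ p ≡ x ^ p + y ^ p mod p
freshmans-dream-ℤ {p} pr x y = let v , dream = freshmans-dream ℤ.+-*-commutativeSemiring pr x y in begin
  (x + y) ^ p
    ≡⟨ semiring-^≡^ (x + y) p ⟨
  (x + y) ℤ-Exp.^ p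
    ≡⟨ dream ⟩
  x ℤ-Exp.^ p + y ℤ-Exp.^ p + p ℤ-Mult.× v
    ≡⟨ cong₂ (λ u w → u + w + p ℤ-Mult.× v) (semiring-^≡^ x p) (semiring-^≡^ y p) ⟩
  x ^ p + y ^ p + p ℤ-Mult.× v
    ≡⟨ cong (_+_ (x ^ p + y ^ p)) (semiring-×≡* p v) ⟩
  x ^ p + y ^ p + + p * v
    ≈⟨ +-cong-mod (≡-mod-refl (x ^ p + y ^ p)) (multiple≡0-mod v) ⟩
  x ^ p + y ^ p + 0ℤ
    ≡⟨ ℤ.+-identityʳ (x ^ p + y ^ p) ⟩
  x ^ p + y ^ p
    ∎
  where open import Relation.Binary.Reasoning.Setoid (≡-mod-setoid {p})

fermat-little : ∀ {p} → Prime p → ∀ a → (+ a) ^ p ≡ + a mod p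
fermat-little {suc m} _  zero    = ≡⇒≡-mod (ℤ.*-zeroˡ (0ℤ ^ m))
fermat-little {p}     pr (suc a) = begin
  (1ℤ + + a) ^ p      ≈⟨ freshmans-dream-ℤ pr 1ℤ (+ a) ⟩
  1ℤ ^ p + (+ a) ^ p  ≈⟨ +-cong-mod (≡⇒≡-mod (ℤ.^-zeroˡ p)) (fermat-little pr a) ⟩
  1ℤ + + a            ∎
  where open import Relation.Binary.Reasoning.Setoid (≡-mod-setoid {p})

fermat-little-unit : ∀ {n} → Prime (suc n) → ∀ a → ¬ (+ suc n ∣ + a) → (+ a) ^ n ≡ 1ℤ mod suc n
fermat-little-unit pr a p∤a =
  *-cancelˡ-mod pr p∤a (≡-mod-trans (fermat-little pr a) (≡⇒≡-mod (≡.sym (ℤ.*-identityʳ (+ a)))))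

-- The golden ring ℤ[φ]

infixl 6 _+φ_
infixl 7 _*φ_
infix  5 _⊕_

-- a ⊕ b stands for a + bφ, where φ² = φ + 1. A data type rather than a record, so that nested
-- operations compute to explicit component polynomials, as the ring solver needs.
data ℤ[φ] : Set where
  _⊕_ : ℤ → ℤ → ℤ[φ]

c₀ c₁ : ℤ[φ] → ℤ
c₀ (a ⊕ _) = a
c₁ (_ ⊕ b) = b

_+φ_ : ℤ[φ] → ℤ[φ] → ℤ[φ]
(a ⊕ b) +φ (c ⊕ d) = (a + c) ⊕ (b + d)

_*φ_ : ℤ[φ] → ℤ[φ] → ℤ[φ]
(a ⊕ b) *φ (c ⊕ d) = (a * c + b * d) ⊕ (a * d + b * c + b * d)

0φ 1φ φ : ℤ[φ]
0φ = 0ℤ ⊕ 0ℤ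
1φ = 1ℤ ⊕ 0ℤ
φ  = 0ℤ ⊕ 1ℤ

ι : ℤ → ℤ[φ]
ι a = a ⊕ 0ℤ

norm : ℤ[φ] → ℤ
norm (a ⊕ b) = a * a + a * b - b * b

open import Algebra.Definitions {A = ℤ[φ]} _≡_ using (Associative)
open import Algebra.Structures {A = ℤ[φ]} _≡_ using (IsSemigroup)
open import Algebra.Structures.Biased {A = ℤ[φ]} _≡_ using (isCommutativeMonoidˡ; isCommutativeSemiringˡ)

ℤ[φ]-commutativeSemiring : CommutativeSemiring 0ℓ 0ℓ
ℤ[φ]-commutativeSemiring = record
  { _+_ = _+φ_
  ; _*_ = _*φ_
  ; 0#  = 0φ
  ; 1#  = 1φ
  ; isCommutativeSemiring = isCommutativeSemiringˡ record
    { +-isCommutativeMonoid = isCommutativeMonoidˡ record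
      { isSemigroup = isSemigroup _+φ_ λ where
          (a ⊕ b) (c ⊕ d) (e ⊕ f) → cong₂ _⊕_ (ℤ.+-assoc a c e) (ℤ.+-assoc b d f)
      ; identityˡ = λ where (a ⊕ b) → cong₂ _⊕_ (ℤ.+-identityˡ a) (ℤ.+-identityˡ b)
      ; comm      = λ where (a ⊕ b) (c ⊕ d) → cong₂ _⊕_ (ℤ.+-comm a c) (ℤ.+-comm b d)
      }
    ; *-isCommutativeMonoid = isCommutativeMonoidˡ record
      { isSemigroup = isSemigroup _*φ_ λ where
          (a ⊕ b) (c ⊕ d) (e ⊕ f) →
            cong₂ _⊕_ (solve (a ∷ b ∷ c ∷ d ∷ e ∷ f ∷ [])) (solve (a ∷ b ∷ c ∷ d ∷ e ∷ f ∷ []))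
      ; identityˡ = λ where (a ⊕ b) → cong₂ _⊕_ (solve (a ∷ b ∷ [])) (solve (a ∷ b ∷ []))
      ; comm      = λ where
          (a ⊕ b) (c ⊕ d) → cong₂ _⊕_ (solve (a ∷ b ∷ c ∷ d ∷ [])) (solve (a ∷ b ∷ c ∷ d ∷ []))
      }
    ; distribʳ = λ where
        (a ⊕ b) (c ⊕ d) (e ⊕ f) →
          cong₂ _⊕_ (solve (a ∷ b ∷ c ∷ d ∷ e ∷ f ∷ [])) (solve (a ∷ b ∷ c ∷ d ∷ e ∷ f ∷ []))
    ; zeroˡ    = λ where (a ⊕ b) → cong₂ _⊕_ (solve (a ∷ b ∷ [])) (solve (a ∷ b ∷ []))
    }
  }
  where
  isSemigroup : ∀ _∙_ → Associative _∙_ → IsSemigroup _∙_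
  isSemigroup _∙_ assoc = record
    { isMagma = record { isEquivalence = ≡.isEquivalence ; ∙-cong = cong₂ _∙_ }
    ; assoc   = assoc
    }

open CommutativeSemiring ℤ[φ]-commutativeSemiring
  using ()
  renaming (semiring to ℤ[φ]-semiring; +-identityʳ to +φ-identityʳ; *-identityˡ to *φ-identityˡ; *-assoc to *φ-assoc)
module ℤ[φ]-Exp = SemiringExp ℤ[φ]-semiring
module ℤ[φ]-Mult = SemiringMult ℤ[φ]-semiring
open ℤ[φ]-Exp using () renaming (_^_ to _^φ_)
open import Algebra.Properties.CommutativeSemiring.Exp ℤ[φ]-commutativeSemiring using (^-distrib-*)

ι-*φ : ∀ c a b → ι c *φ (a ⊕ b) ≡ (c * a) ⊕ (c * b)
ι-*φ c a b = cong₂ _⊕_ (solve (c ∷ a ∷ b ∷ [])) (solve (c ∷ a ∷ b ∷ []))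

ι-^ : ∀ a k → ι a ^φ k ≡ ι (a ^ k)
ι-^ a zero    = refl
ι-^ a (suc k) =
  ≡.trans (cong (ι a *φ_) (ι-^ a k)) (≡.trans (ι-*φ a (a ^ k) 0ℤ) (cong ((a * a ^ k) ⊕_) (ℤ.*-zeroʳ a)))

×φ-⊕ : ∀ k a b → k ℤ[φ]-Mult.× (a ⊕ b) ≡ (+ k * a) ⊕ (+ k * b)
×φ-⊕ zero    a b = cong₂ _⊕_ (≡.sym (ℤ.*-zeroˡ a)) (≡.sym (ℤ.*-zeroˡ b))
×φ-⊕ (suc k) a b = ≡.trans (cong ((a ⊕ b) +φ_) (×φ-⊕ k a b))
  (cong₂ _⊕_ (≡.sym (ℤ.suc-* (+ k) a)) (≡.sym (ℤ.suc-* (+ k) b)))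

^φ-double : ∀ x k → x ^φ (k ℕ.+ k) ≡ (x *φ x) ^φ k
^φ-double x k = ≡.trans (ℤ[φ]-Exp.^-homo-* x k k) (≡.sym (^-distrib-* x x k))

infix 4 _≡φ_mod_

record _≡φ_mod_ (x y : ℤ[φ]) (m : ℕ) : Set where
  constructor _,_
  field
    c₀-≡ : c₀ x ≡ c₀ y mod m
    c₁-≡ : c₁ x ≡ c₁ y mod m

module _ {m : ℕ} where

  ≡φ-mod-refl : ∀ x → x ≡φ x mod m
  ≡φ-mod-refl x = ≡-mod-refl (c₀ x) , ≡-mod-refl (c₁ x)

  ≡φ-mod-setoid : Setoid _ _
  ≡φ-mod-setoid = record
    { Carrier       = ℤ[φ]
    ; _≈_           = λ x y → x ≡φ y mod m
    ; isEquivalence = record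
      { refl  = ≡φ-mod-refl _
      ; sym   = λ (e₀ , e₁) → ≡-mod-sym e₀ , ≡-mod-sym e₁
      ; trans = λ (e₀ , e₁) (f₀ , f₁) → ≡-mod-trans e₀ f₀ , ≡-mod-trans e₁ f₁
      }
    }

  ι-cong-mod : ∀ {a b} → a ≡ b mod m → ι a ≡φ ι b mod m
  ι-cong-mod e = e , ≡-mod-refl 0ℤ

  +φ-cong-mod : ∀ {x y u v} → x ≡φ y mod m → u ≡φ v mod m → x +φ u ≡φ y +φ v mod m
  +φ-cong-mod {_ ⊕ _} {_ ⊕ _} {_ ⊕ _} {_ ⊕ _} (e₀ , e₁) (f₀ , f₁) =
    +-cong-mod e₀ f₀ , +-cong-mod e₁ f₁

  *φ-cong-mod : ∀ {x y u v} → x ≡φ y mod m → u ≡φ v mod m → x *φ u ≡φ y *φ v mod m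
  *φ-cong-mod {_ ⊕ _} {_ ⊕ _} {_ ⊕ _} {_ ⊕ _} (e₀ , e₁) (f₀ , f₁) =
    +-cong-mod (*-cong-mod e₀ f₀) (*-cong-mod e₁ f₁) ,
    +-cong-mod (+-cong-mod (*-cong-mod e₀ f₁) (*-cong-mod e₁ f₀)) (*-cong-mod e₁ f₁)

  norm-cong-mod : ∀ {x y} → x ≡φ y mod m → norm x ≡ norm y mod m
  norm-cong-mod {_ ⊕ _} {_ ⊕ _} (e₀ , e₁) =
    +-cong-mod (+-cong-mod (*-cong-mod e₀ e₀) (*-cong-mod e₀ e₁)) (neg-cong-mod (*-cong-mod e₁ e₁))

ι-cancelˡ-mod : ∀ {p} → Prime p → ∀ {c} → ¬ (+ p ∣ c) →
                ∀ {x y} → ι c *φ x ≡φ ι c *φ y mod p → x ≡φ y mod p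
ι-cancelˡ-mod {p} pr {c} p∤c {a ⊕ b} {a′ ⊕ b′} e
  with subst₂ (λ x y → x ≡φ y mod p) (ι-*φ c a b) (ι-*φ c a′ b′) e
... | e₀ , e₁ = *-cancelˡ-mod pr p∤c e₀ , *-cancelˡ-mod pr p∤c e₁

freshmans-dream-φ : ∀ {p} → Prime p → ∀ x y → (x +φ y) ^φ p ≡φ x ^φ p +φ y ^φ p mod p
freshmans-dream-φ {p} pr x y = let v , dream = freshmans-dream ℤ[φ]-commutativeSemiring pr x y in begin
  (x +φ y) ^φ p
    ≡⟨ dream ⟩
  x ^φ p +φ y ^φ p +φ p ℤ[φ]-Mult.× v
    ≈⟨ +φ-cong-mod (≡φ-mod-refl (x ^φ p +φ y ^φ p)) (p-multiple v) ⟩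
  x ^φ p +φ y ^φ p +φ 0φ
    ≡⟨ +φ-identityʳ (x ^φ p +φ y ^φ p) ⟩
  x ^φ p +φ y ^φ p
    ∎
  where
  open import Relation.Binary.Reasoning.Setoid (≡φ-mod-setoid {p})
  p-multiple : ∀ v → p ℤ[φ]-Mult.× v ≡φ 0φ mod p
  p-multiple (a ⊕ b) rewrite ×φ-⊕ p a b = multiple≡0-mod a , multiple≡0-mod b

-- 2φ - 1, whose square is 5
√5 : ℤ[φ]
√5 = - 1ℤ ⊕ + 2

module _ {h : ℕ} (pr : Prime (1+2* h)) (2<p : 2 < 1+2* h) (5^h≡-1 : (+ 5) ^ h ≡ - 1ℤ mod 1+2* h) where

  private
    p : ℕ
    p = 1+2* h

  φ^p≡1-φ : φ ^φ p ≡φ 1ℤ ⊕ - 1ℤ mod p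
  φ^p≡1-φ = ι-cancelˡ-mod pr p∤2 (begin
    ι (+ 2) *φ φ ^φ p           ≈⟨ *φ-cong-mod 2≡2^p (≡φ-mod-refl (φ ^φ p)) ⟩
    ι (+ 2) ^φ p *φ φ ^φ p      ≡⟨ ^-distrib-* (ι (+ 2)) φ p ⟨
    (√5 +φ 1φ) ^φ p             ≈⟨ freshmans-dream-φ pr √5 1φ ⟩
    √5 ^φ p +φ 1φ ^φ p          ≡⟨ cong₂ _+φ_ √5^p 1^p ⟩
    √5 *φ ι ((+ 5) ^ h) +φ 1φ   ≈⟨ +φ-cong-mod (*φ-cong-mod (≡φ-mod-refl √5) (ι-cong-mod 5^h≡-1))
                                                 (≡φ-mod-refl 1φ) ⟩
    √5 *φ ι (- 1ℤ) +φ 1φ        ≡⟨⟩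
    ι (+ 2) *φ (1ℤ ⊕ - 1ℤ)      ∎)
    where
    open import Relation.Binary.Reasoning.Setoid (≡φ-mod-setoid {p})
    p∤2 : ¬ (+ p ∣ + 2)
    p∤2 p∣2 = ℕ.<⇒≱ 2<p (ℕ.∣⇒≤ (∣⇒∣ᵤ p∣2))
    2≡2^p : ι (+ 2) ≡φ ι (+ 2) ^φ p mod p
    2≡2^p rewrite ι-^ (+ 2) p = ι-cong-mod (≡-mod-sym (fermat-little pr 2))
    √5^p : √5 ^φ p ≡ √5 *φ ι ((+ 5) ^ h)
    √5^p = cong (√5 *φ_) (≡.trans (^φ-double √5 h) (ι-^ (+ 5) h))
    1^p : 1φ ^φ p ≡ 1φ
    1^p = ≡.trans (ι-^ 1ℤ p) (cong ι (ℤ.^-zeroˡ p))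

  [1+φ]^h≡φ-2 : (1ℤ ⊕ 1ℤ) ^φ h ≡φ - + 2 ⊕ 1ℤ mod p
  [1+φ]^h≡φ-2 = begin
    (1ℤ ⊕ 1ℤ) ^φ h                          ≡⟨ *φ-identityˡ _ ⟨
    ((- 1ℤ ⊕ 1ℤ) *φ φ) *φ (1ℤ ⊕ 1ℤ) ^φ h    ≡⟨ *φ-assoc (- 1ℤ ⊕ 1ℤ) φ _ ⟩
    (- 1ℤ ⊕ 1ℤ) *φ (φ *φ (φ *φ φ) ^φ h)     ≡⟨ cong (λ u → (- 1ℤ ⊕ 1ℤ) *φ (φ *φ u)) (^φ-double φ h) ⟨
    (- 1ℤ ⊕ 1ℤ) *φ φ ^φ p                   ≈⟨ *φ-cong-mod (≡φ-mod-refl (- 1ℤ ⊕ 1ℤ)) φ^p≡1-φ ⟩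
    (- 1ℤ ⊕ 1ℤ) *φ (1ℤ ⊕ - 1ℤ)              ≡⟨⟩
    - + 2 ⊕ 1ℤ                              ∎
    where open import Relation.Binary.Reasoning.Setoid (≡φ-mod-setoid {p})

-- The augmentation ℤ[ζ_p] → ℤ

Σ≡sum : ∀ m (f : Vector ℤ m) → Σ m f ≡ sum f
Σ≡sum zero    f = refl
Σ≡sum (suc m) f = cong (_+_ (f Fin.zero)) (Σ≡sum m (tail f))

sum-neg : ∀ {m} (f : Vector ℤ m) → sum (λ i → - f i) ≡ - sum f
sum-neg {zero}  f = refl
sum-neg {suc m} f =
  ≡.trans (cong (_+_ (- f Fin.zero)) (sum-neg (tail f))) (≡.sym (ℤ.neg-distrib-+ (f Fin.zero) (sum (tail f))))

sum-point-mass : ∀ {m} (f : Vector ℤ (suc m)) t →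
                 f t ≡ 1ℤ → (∀ i → i ≢ t → f i ≡ 0ℤ) → sum f ≡ 1ℤ
sum-point-mass {m} f t f[t]≡1 f[i]≡0 = begin
  sum f
    ≡⟨ sum-remove f ⟩
  f t + sum (removeAt f t)
    ≡⟨ cong₂ _+_ f[t]≡1 (sum-cong-≗ {m} (λ j → f[i]≡0 _ (Fin.punchInᵢ≢i t j))) ⟩
  1ℤ + sum {m} (λ _ → 0ℤ)
    ≡⟨ cong (_+_ 1ℤ) (sum-replicate-zero m) ⟩
  1ℤ
    ∎
  where open ≡-Reasoning

[m%n+k]%n≡[m+k]%n : ∀ m k n .{{_ : ℕ.NonZero n}} → (m ℕ.% n ℕ.+ k) ℕ.% n ≡ (m ℕ.+ k) ℕ.% n
[m%n+k]%n≡[m+k]%n m k n = begin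
  (m ℕ.% n ℕ.+ k) ℕ.% n              ≡⟨ ℕ.%-distribˡ-+ (m ℕ.% n) k n ⟩
  (m ℕ.% n ℕ.% n ℕ.+ k ℕ.% n) ℕ.% n  ≡⟨ cong (λ r → (r ℕ.+ k ℕ.% n) ℕ.% n) (ℕ.m%n%n≡m%n m n) ⟩
  (m ℕ.% n ℕ.+ k ℕ.% n) ℕ.% n        ≡⟨ ℕ.%-distribˡ-+ m k n ⟨
  (m ℕ.+ k) ℕ.% n                    ∎
  where open ≡-Reasoning

module _ {p : ℕ} .{{_ : ℕ.NonZero p}} where

  rotate : ℕ → Fin p → Fin p
  rotate a k = (toℕ k ℕ.+ a) ℕ.mod p

  rotate-inverse : ∀ {a b} → a ℕ.+ b ≡ p → ∀ k → rotate b (rotate a k) ≡ k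
  rotate-inverse {a} {b} a+b≡p k = Fin.toℕ-injective (begin
    toℕ (rotate b (rotate a k))         ≡⟨ Fin.toℕ-fromℕ< _ ⟩
    (toℕ (rotate a k) ℕ.+ b) ℕ.% p      ≡⟨ cong (λ r → (r ℕ.+ b) ℕ.% p) (Fin.toℕ-fromℕ< _) ⟩
    ((toℕ k ℕ.+ a) ℕ.% p ℕ.+ b) ℕ.% p   ≡⟨ [m%n+k]%n≡[m+k]%n (toℕ k ℕ.+ a) b p ⟩
    (toℕ k ℕ.+ a ℕ.+ b) ℕ.% p           ≡⟨ cong (ℕ._% p) (≡.trans (ℕ.+-assoc (toℕ k) a b)
                                                                    (cong (toℕ k ℕ.+_) a+b≡p)) ⟩
    (toℕ k ℕ.+ p) ℕ.% p                 ≡⟨ ℕ.[m+n]%n≡m%n (toℕ k) p ⟩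
    toℕ k ℕ.% p                         ≡⟨ ℕ.m<n⇒m%n≡m (Fin.toℕ<n k) ⟩
    toℕ k                               ∎)
    where open ≡-Reasoning

  rotation : ∀ a b → a ℕ.+ b ≡ p → Permutation p p
  rotation a b a+b≡p =
    permutation (rotate a) (rotate b) (rotate-inverse (≡.trans (ℕ.+-comm b a) a+b≡p)) (rotate-inverse a+b≡p)

  sum-rotate : ∀ (f : Vector ℤ p) a b → a ℕ.+ b ≡ p → sum (λ k → f (rotate a k)) ≡ sum f
  sum-rotate f a b a+b≡p = ≡.sym (sum-permute f (rotation a b a+b≡p))

module _ {n : ℕ} where

  augmentation : Cyc n → ℤ
  augmentation = sum

  augmentation-+ : ∀ x y → augmentation (x +c y) ≡ augmentation x + augmentation y
  augmentation-+ = ∑-distrib-+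

  augmentation-neg : ∀ x → augmentation (-c x) ≡ - augmentation x
  augmentation-neg = sum-neg

  augmentation-- : ∀ x y → augmentation (x -c y) ≡ augmentation x - augmentation y
  augmentation-- x y = ≡.trans (augmentation-+ x (-c y)) (cong (_+_ (augmentation x)) (augmentation-neg y))

  augmentation-* : ∀ x y → augmentation (x *c y) ≡ augmentation x * augmentation y
  augmentation-* x y = begin
    sum (λ k → Σ p (λ i → x i * y (shift i k)))
      ≡⟨ sum-cong-≗ {p} (λ k → Σ≡sum p (λ i → x i * y (shift i k))) ⟩
    sum (λ k → sum (λ i → x i * y (shift i k)))
      ≡⟨ ∑-comm (λ i k → x i * y (shift i k)) ⟨
    sum (λ i → sum (λ k → x i * y (shift i k)))
      ≡⟨ sum-cong-≗ {p} (λ i → *-distribˡ-sum (x i) (λ k → y (shift i k))) ⟨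
    sum (λ i → x i * sum (λ k → y (shift i k)))
      ≡⟨ sum-cong-≗ {p} (λ i → cong (_*_ (x i)) (sum-shift i)) ⟩
    sum (λ i → x i * sum y)
      ≡⟨ *-distribʳ-sum (sum y) x ⟨
    sum x * sum y
      ∎
    where
    open ≡-Reasoning
    p = suc n
    shift : Fin p → Fin p → Fin p
    shift i k = ((toℕ k ℕ.+ p) ℕ.∸ toℕ i) ℕ.mod p
    sum-shift : ∀ i → sum (λ k → y (shift i k)) ≡ sum y
    sum-shift i = ≡.trans
      (sum-cong-≗ {p} λ k → cong (λ m → y (m ℕ.mod p)) (ℕ.+-∸-assoc (toℕ k) (ℕ.<⇒≤ (Fin.toℕ<n i))))
      (sum-rotate y (p ℕ.∸ toℕ i) (toℕ i) (ℕ.m∸n+n≡m (ℕ.<⇒≤ (Fin.toℕ<n i))))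

  augmentation-ζ^ : ∀ k → augmentation (ζ^ k) ≡ 1ℤ
  augmentation-ζ^ k = sum-point-mass (ζ^ k) (k ℕ.mod suc n) hit miss
    where
    hit : ζ^ {n} k (k ℕ.mod suc n) ≡ 1ℤ
    hit with toℕ (k ℕ.mod suc n) ℕ.≟ toℕ (k ℕ.mod suc n)
    ... | yes _ = refl
    ... | no ≢  = ⊥-elim (≢ refl)
    miss : ∀ i → i ≢ k ℕ.mod suc n → ζ^ {n} k i ≡ 0ℤ
    miss i i≢ with toℕ i ℕ.≟ toℕ (k ℕ.mod suc n)
    ... | yes eq = ⊥-elim (i≢ (Fin.toℕ-injective eq))
    ... | no _   = refl

  augmentation-0c : augmentation 0c ≡ 0ℤ
  augmentation-0c = sum-replicate-zero (suc n)

  augmentation-1c : augmentation 1c ≡ 1ℤ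
  augmentation-1c = augmentation-ζ^ 0

  ≈0c⇒p∣augmentation : ∀ x → x ≈ 0c → + suc n ∣ augmentation x
  ≈0c⇒p∣augmentation x x≈0 = divides (x Fin.zero) (begin
    sum x                           ≡⟨ sum-cong-≗ {suc n} constant ⟩
    sum {suc n} (λ _ → x Fin.zero)  ≡⟨ sum-replicate (suc n) {x Fin.zero} ⟩
    suc n ℤ-Mult.× x Fin.zero       ≡⟨ semiring-×≡* (suc n) (x Fin.zero) ⟩
    + suc n * x Fin.zero            ≡⟨ ℤ.*-comm (+ suc n) (x Fin.zero) ⟩
    x Fin.zero * + suc n            ∎)
    where
    open ≡-Reasoning
    constant : ∀ i → x i ≡ x Fin.zero
    constant i = ≡.trans (≡.sym (ℤ.+-identityʳ (x i))) (≡.trans (x≈0 i) (ℤ.+-identityʳ (x Fin.zero)))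

  augmentation-row : ∀ x y v w {α β γ δ} →
                     augmentation x ≡ α → augmentation y ≡ β → augmentation v ≡ γ → augmentation w ≡ δ →
                     augmentation ((x *c v) +c (y *c w)) ≡ α * γ + β * δ
  augmentation-row x y v w refl refl refl refl =
    ≡.trans (augmentation-+ (x *c v) (y *c w)) (cong₂ _+_ (augmentation-* x v) (augmentation-* y w))

  -- The entrywise augmentation of X is the image of u₀ + u₁φ under the ring embedding
  -- ℤ[φ] → M₂(ℤ), a + bφ ↦ [[a - b, b], [-b, a + 2b]], which sends φ to g(1) - I and 1 + φ to g(1).
  Represents : M2 {n} → ℤ[φ] → Set
  Represents (mat x₁₁ x₁₂ x₂₁ x₂₂) (u₀ ⊕ u₁) =
    augmentation x₁₁ ≡ u₀ - u₁ × augmentation x₁₂ ≡ u₁ ×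
    augmentation x₂₁ ≡ - u₁    × augmentation x₂₂ ≡ u₀ + + 2 * u₁

  represents-g*M : ∀ z {X u} → augmentation z ≡ 1ℤ → Represents X u → Represents (g z *M X) ((1ℤ ⊕ 1ℤ) *φ u)
  represents-g*M z {mat x₁₁ x₁₂ x₂₁ x₂₂} {u₀ ⊕ u₁} aug-z (e₁₁ , e₁₂ , e₂₁ , e₂₂) =
    ≡.trans (augmentation-row 0c 1c x₁₁ x₂₁ augmentation-0c augmentation-1c e₁₁ e₂₁) (solve (u₀ ∷ u₁ ∷ [])) ,
    ≡.trans (augmentation-row 0c 1c x₁₂ x₂₂ augmentation-0c augmentation-1c e₁₂ e₂₂) (solve (u₀ ∷ u₁ ∷ [])) ,
    ≡.trans (augmentation-row (-c z) w x₁₁ x₂₁ aug-[-z] aug-w e₁₁ e₂₁) (solve (u₀ ∷ u₁ ∷ [])) ,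
    ≡.trans (augmentation-row (-c z) w x₁₂ x₂₂ aug-[-z] aug-w e₁₂ e₂₂) (solve (u₀ ∷ u₁ ∷ []))
    where
    w = ((z *c z) +c z) +c 1c
    aug-[-z] : augmentation (-c z) ≡ - 1ℤ
    aug-[-z] = ≡.trans (augmentation-neg z) (cong -_ aug-z)
    aug-w : augmentation w ≡ + 3
    aug-w = ≡.trans (augmentation-+ ((z *c z) +c z) 1c) (cong₂ _+_
      (≡.trans (augmentation-+ (z *c z) z)
               (cong₂ _+_ (≡.trans (augmentation-* z z) (cong₂ _*_ aug-z aug-z)) aug-z))
      augmentation-1c)

  γ-prod-represents : ∀ k → Represents (γ-prod {n} k) ((1ℤ ⊕ 1ℤ) ^φ k)
  γ-prod-represents zero    = augmentation-1c , augmentation-0c , augmentation-0c , augmentation-1c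
  γ-prod-represents (suc k) = represents-g*M (ζ^ (4 ℕ.^ k)) (augmentation-ζ^ (4 ℕ.^ k)) (γ-prod-represents k)

  eigenvalue⇒p∣norm : ∀ X {u} j → Represents X u → IsEigenvalue X (ζ^ j) →
                      + suc n ∣ norm (u +φ ι (- 1ℤ))
  eigenvalue⇒p∣norm (mat x₁₁ x₁₂ x₂₁ x₂₂) {u₀ ⊕ u₁} j (e₁₁ , e₁₂ , e₂₁ , e₂₂) eigen =
    subst (+ suc n ∣_) augmentation-det (≈0c⇒p∣augmentation det eigen)
    where
    μ = ζ^ j
    det = ((x₁₁ -c μ) *c (x₂₂ -c μ)) -c (x₁₂ *c x₂₁)
    aug-[x-μ] : ∀ x {α} → augmentation x ≡ α → augmentation (x -c μ) ≡ α - 1ℤ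
    aug-[x-μ] x refl = ≡.trans (augmentation-- x μ) (cong (_-_ (augmentation x)) (augmentation-ζ^ j))
    augmentation-det : augmentation det ≡ norm (u₀ + - 1ℤ ⊕ u₁ + 0ℤ)
    augmentation-det = begin
      augmentation det
        ≡⟨ augmentation-- ((x₁₁ -c μ) *c (x₂₂ -c μ)) (x₁₂ *c x₂₁) ⟩
      augmentation ((x₁₁ -c μ) *c (x₂₂ -c μ)) - augmentation (x₁₂ *c x₂₁)
        ≡⟨ cong₂ _-_ (≡.trans (augmentation-* (x₁₁ -c μ) (x₂₂ -c μ))
                              (cong₂ _*_ (aug-[x-μ] x₁₁ e₁₁) (aug-[x-μ] x₂₂ e₂₂)))
                     (≡.trans (augmentation-* x₁₂ x₂₁) (cong₂ _*_ e₁₂ e₂₁)) ⟩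
      (u₀ - u₁ - 1ℤ) * (u₀ + + 2 * u₁ - 1ℤ) - u₁ * - u₁
        ≡⟨ solve (u₀ ∷ u₁ ∷ []) ⟩
      (u₀ + - 1ℤ) * (u₀ + - 1ℤ) + (u₀ + - 1ℤ) * (u₁ + 0ℤ) - (u₁ + 0ℤ) * (u₁ + 0ℤ)
        ∎
      where open ≡-Reasoning

-- Primes p ≡ 3 (mod 4) dividing y² + 5

oddFactorial : ℕ → ℕ
oddFactorial zero    = 1
oddFactorial (suc k) = 1+2* suc k ℕ.* oddFactorial k

odd∣oddFactorial : ∀ {j k} → j ℕ.≤ k → 1+2* j ℕ.∣ oddFactorial k
odd∣oddFactorial {zero}          _         = ℕ.1∣ _
odd∣oddFactorial {suc j} {suc k} (s≤s j≤k) with ℕ.m≤n⇒m<n∨m≡n j≤k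
... | inj₁ j<k  = ℕ.∣n⇒∣m*n (1+2* suc k) (odd∣oddFactorial j<k)
... | inj₂ refl = ℕ.m∣m*n (oddFactorial j)

oddFactorial-odd : ∀ k → ∃[ t ] oddFactorial k ≡ 1+2* t
oddFactorial-odd zero    = 0 , refl
oddFactorial-odd (suc k) =
  let t , e = oddFactorial-odd k in
  t ℕ.* (k ℕ.+ k) ℕ.+ 3 ℕ.* t ℕ.+ k ℕ.+ 1 , ≡.trans (cong (1+2* suc k ℕ.*_) e) (identity k t)
  where
  identity : ∀ k t → suc (suc k ℕ.+ suc k) ℕ.* suc (t ℕ.+ t)
                   ≡ suc ((t ℕ.* (k ℕ.+ k) ℕ.+ 3 ℕ.* t ℕ.+ k ℕ.+ 1) ℕ.+ (t ℕ.* (k ℕ.+ k) ℕ.+ 3 ℕ.* t ℕ.+ k ℕ.+ 1))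
  identity = ℕ-Solver.solve-∀

*-%4≡3 : ∀ a b → (a ℕ.* b) ℕ.% 4 ≡ 3 → a ℕ.% 4 ≡ 3 ⊎ b ℕ.% 4 ≡ 3
*-%4≡3 a b e =
  residues (a ℕ.% 4) (b ℕ.% 4) (ℕ.m%n<n a 4) (ℕ.m%n<n b 4) (≡.trans (≡.sym (ℕ.%-distribˡ-* a b 4)) e)
  where
  residues : ∀ u v → u < 4 → v < 4 → (u ℕ.* v) ℕ.% 4 ≡ 3 → u ≡ 3 ⊎ v ≡ 3
  residues 3 _ _ _ _ = inj₁ refl
  residues _ 3 _ _ _ = inj₂ refl
  residues 0 0 _ _ ()
  residues 0 1 _ _ ()
  residues 0 2 _ _ ()
  residues 1 0 _ _ ()
  residues 1 1 _ _ ()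
  residues 1 2 _ _ ()
  residues 2 0 _ _ ()
  residues 2 1 _ _ ()
  residues 2 2 _ _ ()
  residues (suc (suc (suc (suc _)))) _ (s≤s (s≤s (s≤s (s≤s ())))) _ _
  residues _ (suc (suc (suc (suc _)))) _ (s≤s (s≤s (s≤s (s≤s ())))) _

prime-factor-≡3-mod-4 : ∀ {qs} → All Prime qs → product qs ℕ.% 4 ≡ 3 →
                        ∃[ q ] Prime q × q ℕ.∣ product qs × q ℕ.% 4 ≡ 3
prime-factor-≡3-mod-4 {[]}     _      ()
prime-factor-≡3-mod-4 {q ∷ qs} primes e with *-%4≡3 q (product qs) e
... | inj₁ q%4≡3 = q , All.head primes , ℕ.m∣m*n (product qs) , q%4≡3
... | inj₂ e′    = let q′ , q′-prime , q′∣ , q′%4≡3 = prime-factor-≡3-mod-4 (All.tail primes) e′ in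
                   q′ , q′-prime , ℕ.∣n⇒∣m*n q q′∣ , q′%4≡3

≡3-mod-4⇒∤5 : ∀ {q} → q ℕ.% 4 ≡ 3 → ¬ (q ℕ.∣ 5)
≡3-mod-4⇒∤5 q%4≡3 q∣5 with prime⇒irreducible (from-yes (prime? 5)) q∣5 | q%4≡3
... | inj₁ refl | ()
... | inj₂ refl | ()

≡3-mod-4⇒≡4r+3 : ∀ {q} → q ℕ.% 4 ≡ 3 → ∃[ r ] q ≡ 1+2* 1+2* r
≡3-mod-4⇒≡4r+3 {q} q%4≡3 =
  q ℕ./ 4 ,
  ≡.trans (ℕ.m≡m%n+[m/n]*n q 4) (≡.trans (cong (ℕ._+ q ℕ./ 4 ℕ.* 4) q%4≡3) (identity (q ℕ./ 4)))
  where
  identity : ∀ r → 3 ℕ.+ r ℕ.* 4 ≡ suc (suc (r ℕ.+ r) ℕ.+ suc (r ℕ.+ r))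
  identity = ℕ-Solver.solve-∀

∤oddFactorial⇒> : ∀ {j} k → ¬ (1+2* j ℕ.∣ oddFactorial k) → k < 1+2* j
∤oddFactorial⇒> {j} k ∤ = ℕ.≰⇒> λ 1+2j≤k →
  ∤ (odd∣oddFactorial (ℕ.≤-trans (ℕ.≤-trans (ℕ.m≤m+n j j) (ℕ.n≤1+n _)) 1+2j≤k))

large-prime-∣y²+5 : ∀ N → ∃[ p ] ∃[ y ] Prime p × N ℕ.+ 5 < p × p ℕ.% 4 ≡ 3 × p ℕ.∣ y ℕ.* y ℕ.+ 5
large-prime-∣y²+5 N =
  let t , Q≡1+2t = oddFactorial-odd K
      factorisation = factorise (3 ℕ.+ s t ℕ.* 4)
      M≡∏ = PrimeFactorisation.isFactorisation factorisation
      q , q-prime , q∣M , q%4≡3 = prime-factor-≡3-mod-4 (PrimeFactorisation.factorsPrime factorisation)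
        (subst (λ m → m ℕ.% 4 ≡ 3) M≡∏ (ℕ.[m+kn]%n≡m%n 3 (s t) 4))
      q∣y²+5 = subst (q ℕ.∣_) (≡.sym (≡.trans (y²+5≡[3+4s]*2 {t} Q≡1+2t) (cong (ℕ._* 2) M≡∏)))
                     (ℕ.∣m⇒∣m*n 2 q∣M)
      q∤Q = λ q∣Q → ≡3-mod-4⇒∤5 q%4≡3 (ℕ.∣m+n∣m⇒∣n q∣y²+5 (ℕ.∣m⇒∣m*n y (ℕ.∣m⇒∣m*n Q q∣Q)))
      r , q≡4r+3 = ≡3-mod-4⇒≡4r+3 q%4≡3
      K<q = subst (K <_) (≡.sym q≡4r+3)
                  (∤oddFactorial⇒> {1+2* r} K λ ∣Q → q∤Q (subst (ℕ._∣ Q) (≡.sym q≡4r+3) ∣Q))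
  in q , y , q-prime , K<q , q%4≡3 , q∣y²+5
  where
  K = N ℕ.+ 5
  Q = oddFactorial K
  y = Q ℕ.* Q
  s : ℕ → ℕ
  s t = 2 ℕ.* (t ℕ.* t ℕ.+ t) ℕ.* (t ℕ.* t ℕ.+ t) ℕ.+ (t ℕ.* t ℕ.+ t)
  y²+5≡[3+4s]*2 : ∀ {t} → Q ≡ 1+2* t → y ℕ.* y ℕ.+ 5 ≡ (3 ℕ.+ s t ℕ.* 4) ℕ.* 2
  y²+5≡[3+4s]*2 {t} Q≡1+2t = ≡.trans (cong (λ Q → Q ℕ.* Q ℕ.* (Q ℕ.* Q) ℕ.+ 5) Q≡1+2t) (identity t)
    where
    identity : ∀ t → suc (t ℕ.+ t) ℕ.* suc (t ℕ.+ t) ℕ.* (suc (t ℕ.+ t) ℕ.* suc (t ℕ.+ t)) ℕ.+ 5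
                   ≡ (3 ℕ.+ (2 ℕ.* (t ℕ.* t ℕ.+ t) ℕ.* (t ℕ.* t ℕ.+ t) ℕ.+ (t ℕ.* t ℕ.+ t)) ℕ.* 4) ℕ.* 2
    identity = ℕ-Solver.solve-∀

-- Eigenvalues of γ_p

[h+h]/2≡h : ∀ h → (h ℕ.+ h) ℕ./ 2 ≡ h
[h+h]/2≡h h =
  ≡.trans (cong (ℕ._/ 2) (≡.trans (cong (h ℕ.+_) (≡.sym (ℕ.+-identityʳ h))) (ℕ.*-comm 2 h))) (ℕ.m*n/n≡m h 2)

module _ {r y : ℕ} (pr : Prime (1+2* 1+2* r)) (5<p : 5 < 1+2* 1+2* r)
         (p∣y²+5 : 1+2* 1+2* r ℕ.∣ y ℕ.* y ℕ.+ 5) where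

  private
    h p : ℕ
    h = 1+2* r
    p = 1+2* h

  5^h≡-1 : (+ 5) ^ h ≡ - 1ℤ mod p
  5^h≡-1 = begin
    (+ 5) ^ h                ≡⟨ ℤ.neg-involutive _ ⟨
    - - ((+ 5) ^ h)          ≡⟨ cong -_ (-‿^-odd (+ 5) r) ⟨
    - ((- + 5) ^ h)          ≈⟨ neg-cong-mod (^-cong-mod h (≡-mod-sym y²≡-5)) ⟩
    - ((+ y * + y) ^ h)      ≡⟨ cong -_ (^-double (+ y) h) ⟨
    - ((+ y) ^ (h ℕ.+ h))    ≈⟨ neg-cong-mod (fermat-little-unit pr y p∤y) ⟩
    - 1ℤ                     ∎
    where
    open import Relation.Binary.Reasoning.Setoid (≡-mod-setoid {p})
    p∤y : ¬ (+ p ∣ + y)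
    p∤y p∣y = ℕ.<⇒≱ 5<p (ℕ.∣⇒≤ (ℕ.∣m+n∣m⇒∣n p∣y²+5 (ℕ.∣n⇒∣m*n y (∣⇒∣ᵤ p∣y))))
    y²≡-5 : + y * + y ≡ - + 5 mod p
    y²≡-5 = ≡-mod (subst (λ t → + p ∣ t + + 5) (ℤ.pos-* y y) (∣ᵤ⇒∣ p∣y²+5))

  no-root-of-unity-eigenvalue : NoRootOfUnityEigenvalue {h ℕ.+ h}
  no-root-of-unity-eigenvalue k eigen = ℕ.<⇒≱ 5<p (ℕ.∣⇒≤ (∣⇒∣ᵤ p∣5))
    where
    U = (1ℤ ⊕ 1ℤ) ^φ h
    p∣norm : + p ∣ norm (U +φ ι (- 1ℤ))
    p∣norm = eigenvalue⇒p∣norm (γ-prod h) (toℕ k) (γ-prod-represents h)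
      (subst (λ m → IsEigenvalue (γ-prod {h ℕ.+ h} m) (ζ^ (toℕ k))) ([h+h]/2≡h h) eigen)
    norm≡5 : norm (U +φ ι (- 1ℤ)) ≡ + 5 mod p
    norm≡5 = norm-cong-mod (+φ-cong-mod ([1+φ]^h≡φ-2 pr (ℕ.≤-trans (s≤s (s≤s (s≤s z≤n))) 5<p) 5^h≡-1)
                                         (≡φ-mod-refl (ι (- 1ℤ))))
    p∣5 : + p ∣ + 5
    p∣5 = ≡-mod-∣ norm≡5 p∣norm

lemma4p6 : ∀ (N : ℕ) → ∃[ n ] (N < suc n × 3 < suc n × Prime (suc n) × NoRootOfUnityEigenvalue {n})
lemma4p6 N = from-large-prime (large-prime-∣y²+5 N)
  where
  from-large-prime : ∃[ p ] ∃[ y ] Prime p × N ℕ.+ 5 < p × p ℕ.% 4 ≡ 3 × p ℕ.∣ y ℕ.* y ℕ.+ 5 →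
                     ∃[ n ] (N < suc n × 3 < suc n × Prime (suc n) × NoRootOfUnityEigenvalue {n})
  from-large-prime (p , y , pr , N+5<p , p%4≡3 , p∣y²+5) with ≡3-mod-4⇒≡4r+3 {p} p%4≡3
  ... | r , refl = _ , N<p , ℕ.≤-trans (s≤s (s≤s (s≤s (s≤s z≤n)))) 5<p , pr ,
                   no-root-of-unity-eigenvalue {r} {y} pr 5<p p∣y²+5
    where
    N<p = ℕ.≤-trans (s≤s (ℕ.m≤m+n N 5)) N+5<p
    5<p = ℕ.≤-trans (s≤s (ℕ.m≤n+m 5 N)) N+5<p
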